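{- Let $x$ be a formal variable. For integers $q\ge 1$ and $0<j_1<j_2<\dots<j_q$, define the rational function $$N(x;j_1,\dots,j_q):=(-12)^q\, j_1 j_2\cdots j_q\,\frac{j_1(j_2-j_1)\cdots(j_q-j_{q-1})(x-j_q)}{\prod_{i=1}^{q}\left(x^3-x+j_i-j_i^3\right)}.$$ For each integer $p\ge 1$ let $$B_p(x):=\sum_{q\ge 1}\ \sum_{0<j_1<\dots<j_q=p} N(x;j_1,\dots,j_q),$$ the sum being over all strictly increasing sequences of positive integers whose last element equals $p$ (equivalently, over all subsets of $\{1,\dots,p\}$ containing $p$). Then, as rational functions of $x$, for every integer $p\ge1$, $$B_p(x)=\frac{12\,p^2\,(p-x)}{x(x+1)(x-1)}.$$
   Context: The sequence $(j_1,\dots,j_q)$ is written in increasing order; for $q=1$ the product $j_1(j_2-j_1)\cdots(j_q-j_{q-1})(x-j_q)$ is just $j_1(x-j_1)$. -}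

module Defs where

open import Data.Nat as ℕ using (ℕ; zero; suc)
open import Data.Integer using (+_)
open import Data.List using (List; []; _∷_; _++_; map; _∷ʳ_; foldr; length)
open import Data.Rational using (ℚ; 0ℚ; 1ℚ; _+_; _*_; _-_; -_; 1/_; _/_; ≢-nonZero)
open import Data.Rational.Properties using (_≟_)
open import Relation.Nullary using (yes; no)

⟦_⟧ : ℕ → ℚ
⟦ n ⟧ = (+ n) / 1

-- total inverse on ℚ (inv 0 = 0); only ever used at nonzero arguments
-- under the hypotheses of the main theorem
inv : ℚ → ℚ
inv q with q ≟ 0ℚ
... | yes _ = 0ℚ
... | no q≢0 = 1/_ q {{≢-nonZero q≢0}}

_^_ : ℚ → ℕ → ℚ
q ^ zero = 1ℚ
q ^ suc n = q * (q ^ n)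

prodℚ : List ℚ → ℚ
prodℚ = foldr _*_ 1ℚ

subsets : ℕ → List (List ℕ)
subsets zero = [] ∷ []
subsets (suc n) = subsets n ++ map (_∷ʳ suc n) (subsets n)

chains : ℕ → List (List ℕ)
chains p = map (_∷ʳ p) (subsets (p ℕ.∸ 1))

-- j₁ (j₂ - j₁) ⋯ (j_q - j_{q-1}), computed as ∏ (j_i - j_{i-1}) with j₀ = 0
gaps : ℕ → List ℕ → ℚ
gaps prev [] = 1ℚ
gaps prev (j ∷ js) = (⟦ j ⟧ - ⟦ prev ⟧) * gaps j js

-- last element (0 for the empty list; never used on empty lists)
lastℕ : List ℕ → ℕ
lastℕ [] = 0
lastℕ (j ∷ []) = j
lastℕ (j ∷ k ∷ js) = lastℕ (k ∷ js)

cub : ℚ → ℕ → ℚ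
cub x j = (((x ^ 3) - x) + ⟦ j ⟧) - (⟦ j ⟧ ^ 3)

N : ℚ → List ℕ → ℚ
N x js =
  ((((- ⟦ 12 ⟧) ^ length js) * prodℚ (map ⟦_⟧ js)) *
     (gaps 0 js * (x - ⟦ lastℕ js ⟧)))
  * inv (prodℚ (map (cub x) js))

sumℚ : List ℚ → ℚ
sumℚ = foldr _+_ 0ℚ

B : ℕ → ℚ → ℚ
B p x = sumℚ (map (N x) (chains p))

{-# OPTIONS --safe #-}
module Submission where

-- For fixed x let T n y be the sum over the subsets s of {1,…,n} of N(x; s) with its
-- last factor (x − max s) replaced by (y − max s).  Appending m to s turns that factor
-- into (m − max s) and contributes E_m(y) = −12 m (y − m) / (x³ − x + m − m³), so
-- B_p = T (p−1) p · E_p(x) and T (n+1) y = T n y + T n (n+1) · E_{n+1}(y).  By induction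
-- T n y = y − 12 Σ_{m≤n} m² (y − m) / (x³ − x); at y = n + 1 the power sums make this
-- (n+1)(x³ − x + (n+1) − (n+1)³) / (x³ − x), so the cubic cancels against E_{n+1}.

open import Defs
open import Data.Nat using (ℕ; zero; suc; _≤_; s≤s; z≤n)
import Data.Nat as ℕ
import Data.Nat.Properties as ℕ
import Data.Nat.Coprimality as Coprime
import Data.Integer as ℤ
import Data.Integer.Properties as ℤ
open import Data.List using (List; []; _∷_; _++_; map; _∷ʳ_; length)
open import Data.List.Properties using (map-++; map-cong; map-∘; length-++)
open import Data.Rational using (ℚ; 0ℚ; 1ℚ; _+_; _*_; _-_; -_; _/_; mkℚ; ≢-nonZero)
open import Data.Rational.Properties
  using (_≟_; normalize-coprime; *-inverseʳ; *-comm; *-assoc; *-identityˡ; *-identityʳ;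
         *-zeroˡ; *-zeroʳ; +-identityˡ; +-assoc; *-distribʳ-+)
open import Data.Rational.Solver using (module +-*-Solver)
open +-*-Solver using (Polynomial; solve; _:=_; con; _:+_; _:*_; _:-_; :-_)
open import Relation.Binary.PropositionalEquality
  using (_≡_; _≢_; refl; sym; trans; cong; cong₂; subst; module ≡-Reasoning)
open import Relation.Nullary using (Dec; yes; no; contradiction)

open ≡-Reasoning

⟦1+n⟧≡⟦n⟧+1 : ∀ n → ⟦ suc n ⟧ ≡ ⟦ n ⟧ + 1ℚ
⟦1+n⟧≡⟦n⟧+1 n = sym (begin
  ⟦ n ⟧ + 1ℚ                          ≡⟨ cong (_+ 1ℚ) (normalize-coprime coprime) ⟩
  mkℚ (ℤ.+ n) 0 coprime + 1ℚ          ≡⟨⟩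
  (ℤ.+ n ℤ.* ℤ.+ 1 ℤ.+ ℤ.+ 1) / 1     ≡⟨ cong (λ i → (i ℤ.+ ℤ.+ 1) / 1) (ℤ.*-identityʳ (ℤ.+ n)) ⟩
  ℤ.+ (n ℕ.+ 1) / 1                   ≡⟨ cong (λ m → ℤ.+ m / 1) (ℕ.+-comm n 1) ⟩
  ⟦ suc n ⟧                           ∎)
  where coprime = Coprime.sym (Coprime.1-coprimeTo n)

q^[n+1]≡q^n*q : ∀ q n → q ^ (n ℕ.+ 1) ≡ (q ^ n) * q
q^[n+1]≡q^n*q q zero    = *-comm q 1ℚ
q^[n+1]≡q^n*q q (suc n) = trans (cong (q *_) (q^[n+1]≡q^n*q q n)) (sym (*-assoc q (q ^ n) q))

*-inv : ∀ {a} → a ≢ 0ℚ → a * inv a ≡ 1ℚ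
*-inv {a} a≢0 with a ≟ 0ℚ
... | yes a≡0  = contradiction a≡0 a≢0
... | no  a≢0′ = *-inverseʳ a {{≢-nonZero a≢0′}}

*-≢0 : ∀ {a b} → a ≢ 0ℚ → b ≢ 0ℚ → a * b ≢ 0ℚ
*-≢0 {a} {b} a≢0 b≢0 ab≡0 = b≢0 (begin
  b                   ≡⟨ sym (*-identityˡ b) ⟩
  1ℚ * b              ≡⟨ cong (_* b) (trans (*-comm (inv a) a) (*-inv a≢0)) ⟨
  (inv a * a) * b     ≡⟨ *-assoc (inv a) a b ⟩
  inv a * (a * b)     ≡⟨ cong (inv a *_) ab≡0 ⟩
  inv a * 0ℚ          ≡⟨ *-zeroʳ (inv a) ⟩
  0ℚ                  ∎)

inv-unique : ∀ {a b} → a ≢ 0ℚ → a * b ≡ 1ℚ → inv a ≡ b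
inv-unique {a} {b} a≢0 ab≡1 = begin
  inv a               ≡⟨ sym (*-identityʳ (inv a)) ⟩
  inv a * 1ℚ          ≡⟨ cong (inv a *_) ab≡1 ⟨
  inv a * (a * b)     ≡⟨ sym (*-assoc (inv a) a b) ⟩
  (inv a * a) * b     ≡⟨ cong (_* b) (trans (*-comm (inv a) a) (*-inv a≢0)) ⟩
  1ℚ * b              ≡⟨ *-identityˡ b ⟩
  b                   ∎

-- No side conditions are needed, thanks to the junk value inv 0ℚ = 0ℚ.
inv-* : ∀ a b → inv (a * b) ≡ inv a * inv b
inv-* a b = by-cases (a ≟ 0ℚ) (b ≟ 0ℚ)
  where
  by-cases : Dec (a ≡ 0ℚ) → Dec (b ≡ 0ℚ) → inv (a * b) ≡ inv a * inv b
  by-cases (yes a≡0) _ = subst (λ a → inv (a * b) ≡ inv a * inv b) (sym a≡0)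
    (trans (cong inv (*-zeroˡ b)) (sym (*-zeroˡ (inv b))))
  by-cases (no _) (yes b≡0) = subst (λ b → inv (a * b) ≡ inv a * inv b) (sym b≡0)
    (trans (cong inv (*-zeroʳ a)) (sym (*-zeroʳ (inv a))))
  by-cases (no a≢0) (no b≢0) = inv-unique (*-≢0 a≢0 b≢0) (begin
    (a * b) * (inv a * inv b)
      ≡⟨ solve 4 (λ a b a′ b′ → (a :* b) :* (a′ :* b′) := (a :* a′) :* (b :* b′)) refl a b (inv a) (inv b) ⟩
    (a * inv a) * (b * inv b) ≡⟨ cong₂ _*_ (*-inv a≢0) (*-inv b≢0) ⟩
    1ℚ * 1ℚ                   ≡⟨ *-identityˡ 1ℚ ⟩
    1ℚ                        ∎)

prodℚ-map-∷ʳ : ∀ {A : Set} (f : A → ℚ) xs a → prodℚ (map f (xs ∷ʳ a)) ≡ prodℚ (map f xs) * f a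
prodℚ-map-∷ʳ f []       a = *-comm (f a) 1ℚ
prodℚ-map-∷ʳ f (x ∷ xs) a =
  trans (cong (f x *_) (prodℚ-map-∷ʳ f xs a)) (sym (*-assoc (f x) _ (f a)))

sumℚ-++ : ∀ xs ys → sumℚ (xs ++ ys) ≡ sumℚ xs + sumℚ ys
sumℚ-++ []       ys = sym (+-identityˡ (sumℚ ys))
sumℚ-++ (x ∷ xs) ys = trans (cong (x +_) (sumℚ-++ xs ys)) (sym (+-assoc x (sumℚ xs) (sumℚ ys)))

sumℚ-map-*ʳ : ∀ {A : Set} (f : A → ℚ) c xs → sumℚ (map (λ a → f a * c) xs) ≡ sumℚ (map f xs) * c
sumℚ-map-*ʳ f c []       = sym (*-zeroˡ c)
sumℚ-map-*ʳ f c (x ∷ xs) =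
  trans (cong (f x * c +_) (sumℚ-map-*ʳ f c xs)) (sym (*-distribʳ-+ c (f x) _))

lastℕ-∷ʳ : ∀ s m → lastℕ (s ∷ʳ m) ≡ m
lastℕ-∷ʳ []          m = refl
lastℕ-∷ʳ (j ∷ [])    m = refl
lastℕ-∷ʳ (j ∷ k ∷ s) m = lastℕ-∷ʳ (k ∷ s) m

lastℕ-0∷ : ∀ s → lastℕ (0 ∷ s) ≡ lastℕ s
lastℕ-0∷ []      = refl
lastℕ-0∷ (_ ∷ _) = refl

gaps-∷ʳ : ∀ p s m → gaps p (s ∷ʳ m) ≡ gaps p s * (⟦ m ⟧ - ⟦ lastℕ (p ∷ s) ⟧)
gaps-∷ʳ p []      m = *-comm (⟦ m ⟧ - ⟦ p ⟧) 1ℚ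
gaps-∷ʳ p (j ∷ s) m =
  trans (cong ((⟦ j ⟧ - ⟦ p ⟧) *_) (gaps-∷ʳ j s m)) (sym (*-assoc (⟦ j ⟧ - ⟦ p ⟧) _ _))

-- moment t y = 12 · Σ_{m=1}^{t} m² (y − m), by the closed forms of Σ m² and Σ m³.
moment : ℚ → ℚ → ℚ
moment t y = (((⟦ 2 ⟧ * y) * t) * (t + 1ℚ)) * ((⟦ 2 ⟧ * t) + 1ℚ)
           - (⟦ 3 ⟧ * (t * t)) * ((t + 1ℚ) * (t + 1ℚ))

momentᴾ : ∀ {k} → Polynomial k → Polynomial k → Polynomial k
momentᴾ t y = (((con ⟦ 2 ⟧ :* y) :* t) :* (t :+ con 1ℚ)) :* ((con ⟦ 2 ⟧ :* t) :+ con 1ℚ)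
            :- (con ⟦ 3 ⟧ :* (t :* t)) :* ((t :+ con 1ℚ) :* (t :+ con 1ℚ))

moment-suc : ∀ n y →
  moment ⟦ suc n ⟧ y ≡ moment ⟦ n ⟧ y + ⟦ 12 ⟧ * ((⟦ suc n ⟧ * ⟦ suc n ⟧) * (y - ⟦ suc n ⟧))
moment-suc n y = subst (λ m → moment m y ≡ moment ⟦ n ⟧ y + ⟦ 12 ⟧ * ((m * m) * (y - m)))
  (sym (⟦1+n⟧≡⟦n⟧+1 n))
  (solve 2 (λ t y → momentᴾ (t :+ con 1ℚ) y
                    := momentᴾ t y :+ con ⟦ 12 ⟧ :* (((t :+ con 1ℚ) :* (t :+ con 1ℚ)) :* (y :- (t :+ con 1ℚ))))
         refl ⟦ n ⟧ y)

a-b*inv[c]≡[a*c-b]*inv[c] : ∀ a b {c} → c ≢ 0ℚ → a - b * inv c ≡ (a * c - b) * inv c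
a-b*inv[c]≡[a*c-b]*inv[c] a b {c} c≢0 = sym (begin
  (a * c - b) * inv c         ≡⟨ solve 4 (λ a b c c′ → (a :* c :- b) :* c′ := a :* (c :* c′) :- b :* c′)
                                        refl a b c (inv c) ⟩
  a * (c * inv c) - b * inv c ≡⟨ cong (λ u → a * u - b * inv c) (*-inv c≢0) ⟩
  a * 1ℚ - b * inv c          ≡⟨ cong (_- b * inv c) (*-identityʳ a) ⟩
  a - b * inv c               ∎)

module _ (x : ℚ) where

  x³-x : ℚ
  x³-x = (x * (x + 1ℚ)) * (x - 1ℚ)

  moment-diagonal : ∀ n → ⟦ suc n ⟧ * x³-x - moment ⟦ n ⟧ ⟦ suc n ⟧ ≡ ⟦ suc n ⟧ * cub x (suc n)
  moment-diagonal n = subst (λ m → m * x³-x - moment ⟦ n ⟧ m ≡ m * ((((x ^ 3) - x) + m) - (m ^ 3)))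
    (sym (⟦1+n⟧≡⟦n⟧+1 n))
    (solve 2 (λ x t → let m = t :+ con 1ℚ ; cube = λ z → z :* (z :* (z :* con 1ℚ)) in
                      m :* ((x :* (x :+ con 1ℚ)) :* (x :- con 1ℚ)) :- momentᴾ t m
                      := m :* (((cube x :- x) :+ m) :- cube m))
           refl x ⟦ n ⟧)

  weight : List ℕ → ℚ
  weight s = ((((- ⟦ 12 ⟧) ^ length s) * prodℚ (map ⟦_⟧ s)) * gaps 0 s) * inv (prodℚ (map (cub x) s))

  term : ℚ → List ℕ → ℚ
  term y s = weight s * (y - ⟦ lastℕ s ⟧)

  N≡term : ∀ s → N x s ≡ term x s
  N≡term s = solve 5 (λ c g l x i → (c :* (g :* (x :- l))) :* i := ((c :* g) :* i) :* (x :- l)) refl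
    (((- ⟦ 12 ⟧) ^ length s) * prodℚ (map ⟦_⟧ s)) (gaps 0 s) ⟦ lastℕ s ⟧ x (inv (prodℚ (map (cub x) s)))

  extension : ℕ → ℚ → ℚ
  extension m y = ((- ⟦ 12 ⟧ * ⟦ m ⟧) * inv (cub x m)) * (y - ⟦ m ⟧)

  weight-∷ʳ : ∀ s m →
    weight (s ∷ʳ m) ≡ (weight s * (⟦ m ⟧ - ⟦ lastℕ s ⟧)) * ((- ⟦ 12 ⟧ * ⟦ m ⟧) * inv (cub x m))
  weight-∷ʳ s m = begin
    weight (s ∷ʳ m)
      ≡⟨ cong₂ _*_ (cong₂ _*_ (cong₂ _*_ power (prodℚ-map-∷ʳ ⟦_⟧ s m)) gap) inverse ⟩
    ((((k ^ length s) * k) * (prodℚ (map ⟦_⟧ s) * ⟦ m ⟧)) * (gaps 0 s * (⟦ m ⟧ - ⟦ lastℕ s ⟧)))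
      * (inv (prodℚ (map (cub x) s)) * inv (cub x m))
      ≡⟨ solve 8 (λ a k p m g l i j → (((a :* k) :* (p :* m)) :* (g :* (m :- l))) :* (i :* j)
                                      := ((((a :* p) :* g) :* i) :* (m :- l)) :* ((k :* m) :* j))
               refl (k ^ length s) k (prodℚ (map ⟦_⟧ s)) ⟦ m ⟧ (gaps 0 s) ⟦ lastℕ s ⟧
               (inv (prodℚ (map (cub x) s))) (inv (cub x m)) ⟩
    (weight s * (⟦ m ⟧ - ⟦ lastℕ s ⟧)) * ((k * ⟦ m ⟧) * inv (cub x m)) ∎
    where
    k = - ⟦ 12 ⟧
    power : k ^ length (s ∷ʳ m) ≡ (k ^ length s) * k
    power = trans (cong (k ^_) (length-++ s)) (q^[n+1]≡q^n*q k (length s))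
    gap : gaps 0 (s ∷ʳ m) ≡ gaps 0 s * (⟦ m ⟧ - ⟦ lastℕ s ⟧)
    gap = trans (gaps-∷ʳ 0 s m) (cong (λ l → gaps 0 s * (⟦ m ⟧ - ⟦ l ⟧)) (lastℕ-0∷ s))
    inverse : inv (prodℚ (map (cub x) (s ∷ʳ m))) ≡ inv (prodℚ (map (cub x) s)) * inv (cub x m)
    inverse = trans (cong inv (prodℚ-map-∷ʳ (cub x) s m)) (inv-* (prodℚ (map (cub x) s)) (cub x m))

  term-∷ʳ : ∀ y s m → term y (s ∷ʳ m) ≡ term ⟦ m ⟧ s * extension m y
  term-∷ʳ y s m = trans
    (cong₂ _*_ (weight-∷ʳ s m) (cong (λ l → y - ⟦ l ⟧) (lastℕ-∷ʳ s m)))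
    (*-assoc (term ⟦ m ⟧ s) _ (y - ⟦ m ⟧))

  sumℚ-term-∷ʳ : ∀ y m ss →
    sumℚ (map (term y) (map (_∷ʳ m) ss)) ≡ sumℚ (map (term ⟦ m ⟧) ss) * extension m y
  sumℚ-term-∷ʳ y m ss = begin
    sumℚ (map (term y) (map (_∷ʳ m) ss))              ≡⟨ cong sumℚ (map-∘ ss) ⟨
    sumℚ (map (λ s → term y (s ∷ʳ m)) ss)              ≡⟨ cong sumℚ (map-cong (λ s → term-∷ʳ y s m) ss) ⟩
    sumℚ (map (λ s → term ⟦ m ⟧ s * extension m y) ss) ≡⟨ sumℚ-map-*ʳ (term ⟦ m ⟧) (extension m y) ss ⟩
    sumℚ (map (term ⟦ m ⟧) ss) * extension m y          ∎

  subsetSum : ℕ → ℚ → ℚ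
  subsetSum n y = sumℚ (map (term y) (subsets n))

  subsetSum-suc : ∀ n y →
    subsetSum (suc n) y ≡ subsetSum n y + subsetSum n ⟦ suc n ⟧ * extension (suc n) y
  subsetSum-suc n y = begin
    sumℚ (map (term y) (subsets n ++ map (_∷ʳ suc n) (subsets n)))
      ≡⟨ cong sumℚ (map-++ (term y) (subsets n) _) ⟩
    sumℚ (map (term y) (subsets n) ++ map (term y) (map (_∷ʳ suc n) (subsets n)))
      ≡⟨ sumℚ-++ (map (term y) (subsets n)) _ ⟩
    subsetSum n y + sumℚ (map (term y) (map (_∷ʳ suc n) (subsets n)))
      ≡⟨ cong (subsetSum n y +_) (sumℚ-term-∷ʳ y (suc n) (subsets n)) ⟩
    subsetSum n y + subsetSum n ⟦ suc n ⟧ * extension (suc n) y ∎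

  B-suc : ∀ n → B (suc n) x ≡ subsetSum n ⟦ suc n ⟧ * extension (suc n) x
  B-suc n = trans (cong sumℚ (map-cong N≡term (chains (suc n)))) (sumℚ-term-∷ʳ x (suc n) (subsets n))

  ClosedForm : ℕ → Set
  ClosedForm n = ∀ y → subsetSum n y ≡ y - moment ⟦ n ⟧ y * inv x³-x

  subsetSum-diagonal : x³-x ≢ 0ℚ → ∀ n → ClosedForm n →
    subsetSum n ⟦ suc n ⟧ ≡ (⟦ suc n ⟧ * cub x (suc n)) * inv x³-x
  subsetSum-diagonal x³-x≢0 n closed = begin
    subsetSum n m                           ≡⟨ closed m ⟩
    m - moment ⟦ n ⟧ m * inv x³-x           ≡⟨ a-b*inv[c]≡[a*c-b]*inv[c] m (moment ⟦ n ⟧ m) x³-x≢0 ⟩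
    (m * x³-x - moment ⟦ n ⟧ m) * inv x³-x  ≡⟨ cong (_* inv x³-x) (moment-diagonal n) ⟩
    (m * cub x (suc n)) * inv x³-x          ∎
    where m = ⟦ suc n ⟧

  append-contribution : x³-x ≢ 0ℚ → ∀ n → cub x (suc n) ≢ 0ℚ → ClosedForm n → ∀ y →
    subsetSum n ⟦ suc n ⟧ * extension (suc n) y
      ≡ ((- ⟦ 12 ⟧ * (⟦ suc n ⟧ * ⟦ suc n ⟧)) * (y - ⟦ suc n ⟧)) * inv x³-x
  append-contribution x³-x≢0 n c≢0 closed y = begin
    subsetSum n m * extension (suc n) y
      ≡⟨ cong (_* extension (suc n) y) (subsetSum-diagonal x³-x≢0 n closed) ⟩
    ((m * c) * i) * (((- ⟦ 12 ⟧ * m) * inv c) * (y - m))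
      ≡⟨ solve 5 (λ m c c′ i y → ((m :* c) :* i) :* (((:- con ⟦ 12 ⟧ :* m) :* c′) :* (y :- m))
                                 := (c :* c′) :* (((:- con ⟦ 12 ⟧ :* (m :* m)) :* (y :- m)) :* i))
               refl m c (inv c) i y ⟩
    (c * inv c) * (((- ⟦ 12 ⟧ * (m * m)) * (y - m)) * i)
      ≡⟨ cong (_* (((- ⟦ 12 ⟧ * (m * m)) * (y - m)) * i)) (*-inv c≢0) ⟩
    1ℚ * (((- ⟦ 12 ⟧ * (m * m)) * (y - m)) * i)
      ≡⟨ *-identityˡ _ ⟩
    ((- ⟦ 12 ⟧ * (m * m)) * (y - m)) * i ∎
    where
    m = ⟦ suc n ⟧
    c = cub x (suc n)
    i = inv x³-x

  closedForm : x³-x ≢ 0ℚ → ∀ n → (∀ j → 1 ≤ j → j ≤ n → cub x j ≢ 0ℚ) → ClosedForm n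
  closedForm _ zero _ y =
    solve 2 (λ y i → (((con 1ℚ :* con 1ℚ) :* con 1ℚ) :* con (inv 1ℚ)) :* (y :- con ⟦ 0 ⟧) :+ con 0ℚ
                     := y :- momentᴾ (con ⟦ 0 ⟧) y :* i)
            refl y (inv x³-x)
  closedForm x³-x≢0 (suc n) cubs≢0 y = begin
    subsetSum (suc n) y
      ≡⟨ subsetSum-suc n y ⟩
    subsetSum n y + subsetSum n m * extension (suc n) y
      ≡⟨ cong₂ _+_ (closed y) (append-contribution x³-x≢0 n (cubs≢0 (suc n) (s≤s z≤n) ℕ.≤-refl) closed y) ⟩
    (y - moment ⟦ n ⟧ y * i) + ((- ⟦ 12 ⟧ * (m * m)) * (y - m)) * i
      ≡⟨ solve 4 (λ y f m i → (y :- f :* i) :+ ((:- con ⟦ 12 ⟧ :* (m :* m)) :* (y :- m)) :* i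
                              := y :- (f :+ con ⟦ 12 ⟧ :* ((m :* m) :* (y :- m))) :* i)
               refl y (moment ⟦ n ⟧ y) m i ⟩
    y - (moment ⟦ n ⟧ y + ⟦ 12 ⟧ * ((m * m) * (y - m))) * i
      ≡⟨ cong (λ u → y - u * i) (moment-suc n y) ⟨
    y - moment m y * i ∎
    where
    m = ⟦ suc n ⟧
    i = inv x³-x
    closed = closedForm x³-x≢0 n (λ j 1≤j j≤n → cubs≢0 j 1≤j (ℕ.m≤n⇒m≤1+n j≤n))

mainTheorem1 : (p : ℕ) → 1 ≤ p → (x : ℚ) →
    x ≢ 0ℚ → x + 1ℚ ≢ 0ℚ → x - 1ℚ ≢ 0ℚ →
    ((j : ℕ) → 1 ≤ j → j ≤ p → cub x j ≢ 0ℚ) →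
    B p x ≡ ((⟦ 12 ⟧ * (⟦ p ⟧ ^ 2)) * (⟦ p ⟧ - x)) * inv ((x * (x + 1ℚ)) * (x - 1ℚ))
mainTheorem1 (suc n) _ x x≢0 x+1≢0 x-1≢0 cubs≢0 = begin
  B (suc n) x                                  ≡⟨ B-suc x n ⟩
  subsetSum x n m * extension x (suc n) x      ≡⟨ append-contribution x x³-x≢0 n cub≢0 closed x ⟩
  ((- ⟦ 12 ⟧ * (m * m)) * (x - m)) * i
    ≡⟨ solve 3 (λ m x i → ((:- con ⟦ 12 ⟧ :* (m :* m)) :* (x :- m)) :* i
                          := ((con ⟦ 12 ⟧ :* (m :* (m :* con 1ℚ))) :* (m :- x)) :* i) refl m x i ⟩
  ((⟦ 12 ⟧ * (m ^ 2)) * (m - x)) * i           ∎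
  where
  m = ⟦ suc n ⟧
  i = inv (x³-x x)
  x³-x≢0 = *-≢0 (*-≢0 x≢0 x+1≢0) x-1≢0
  cub≢0 = cubs≢0 (suc n) (s≤s z≤n) ℕ.≤-refl
  closed = closedForm x x³-x≢0 n (λ j 1≤j j≤n → cubs≢0 j 1≤j (ℕ.m≤n⇒m≤1+n j≤n))
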